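{- Let $p$ be a prime such that $2^p-1$ is a (Mersenne) prime. Then $2^{p-1}\cdot(2^p-1)$ is the only even perfect number which is a $3(2p-1)$-$T_0T^\ast$-perfect number.
   Context: A perfect number is a positive integer $n$ with $\sigma(n)=2n$, $\sigma$ the sum-of-divisors function. $T(M)$ denotes the product of all positive divisors of $M$. A divisor $d$ of $M$ is unitary if $\gcd(d,M/d)=1$, and $T^\ast(M)$ denotes the product of all unitary divisors of $M$. For an integer $K\ge 2$, an integer $n>1$ is called $K$-$T_0T^\ast$-perfect if $T(T^\ast(n))=n^K$. -}

module Defs where

open import Data.Nat using (ℕ; zero; suc; _+_; _*_; _∸_; _^_; _≤_; _<_)
open import Data.Nat.Divisibility using (_∣_; _∣?_)
open import Data.Nat.DivMod using (_/_)
open import Data.Nat.GCD using (gcd)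
open import Data.Nat.Properties using (_≟_)
open import Data.List using (List; filter; map; upTo)
open import Data.Nat.ListAction using (sum; product)
open import Data.Product using (_×_)
open import Relation.Binary.PropositionalEquality using (_≡_)
open import Relation.Nullary.Decidable using (_×-dec_)

-- positive divisors of M (as the list of d in 1..M with d ∣ M; empty for M = 0)
divisors : ℕ → List ℕ
divisors M = map suc (filter (λ k → suc k ∣? M) (upTo M))

unitaryDivisors : ℕ → List ℕ
unitaryDivisors M =
  map suc (filter (λ k → (suc k ∣? M) ×-dec (gcd (suc k) (M / suc k) ≟ 1)) (upTo M))

σ : ℕ → ℕ
σ M = sum (divisors M)

T : ℕ → ℕ
T M = product (divisors M)

T* : ℕ → ℕ
T* M = product (unitaryDivisors M)

Perfect : ℕ → Set
Perfect n = 0 < n × σ n ≡ 2 * n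

Even : ℕ → Set
Even n = 2 ∣ n

KT0TStarPerfect : ℕ → ℕ → Set
KT0TStarPerfect K n = 2 ≤ K × 1 < n × T (T* n) ≡ n ^ K

-- Euler: write an even perfect n as 2 ^ k * m with m odd and put M = 2 ^ (k + 1) - 1. Then
-- σ(n) = M σ(m) turns perfectness into (M + 1) m = M σ(m), so m = d M and σ(m) = m + d; as 1, d and m
-- are divisors of m, d = 1, and σ(M) = M + 1 makes M prime.
-- For n = 2 ^ k * q with q an odd prime the unitary divisors are 1, 2 ^ k, q and n, so T*(n) = n²,
-- and the divisors 2 ^ i * q ^ j (i ≤ 2k, j ≤ 2) of n² multiply to n ^ (3 (2k + 1)). As n > 1 this
-- exponent determines k, hence n.

module Submission where

open import Defs
open import Data.Nat
open import Data.Nat.Properties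
open import Data.Nat.Divisibility
open import Data.Nat.DivMod using (_/_; m*n/n≡m; m/n*n≡m)
open import Data.Nat.GCD using (gcd)
open import Data.Nat.Coprimality as Coprime
  using (Coprime; coprime⇒gcd≡1; gcd≡1⇒coprime; coprime-divisor; 1-coprimeTo)
open import Data.Nat.Primality
  using (Prime; prime; prime[2]; prime⇒irreducible; irreducible⇒prime; euclidsLemma; prime⇒nonZero)
open import Data.Nat.Induction using (<-wellFounded)
open import Data.Nat.ListAction using (sum; product)
open import Data.Nat.ListAction.Properties using (sum-↭; product-↭; sum-++; product-++)
open import Data.List using (List; []; _∷_; _++_; map; length; upTo)
open import Data.List.Properties using (length-map; length-++)
open import Data.List.Membership.Propositional using (_∈_)
open import Data.List.Membership.Propositional.Properties
  using (∈-∃++; ∈-map⁻; ∈-map⁺; ∈-filter⁻; ∈-filter⁺; ∈-upTo⁺; ∈-++⁺ˡ; ∈-++⁺ʳ; ∈-++⁻)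
open import Data.List.Membership.Propositional.Properties.WithK using (unique∧set⇒bag)
open import Data.List.Relation.Binary.BagAndSetEquality using (∼bag⇒↭)
open import Data.List.Relation.Binary.Permutation.Propositional using (_↭_; ↭-refl; ↭-trans)
open import Data.List.Relation.Binary.Permutation.Propositional.Properties
  using (∈-resp-↭; shift; ++⁺ˡ; map⁺; ↭-length)
open import Data.List.Relation.Binary.Subset.Propositional using (_⊆_)
open import Data.List.Relation.Unary.Any using (here; there)
import Data.List.Relation.Unary.All as All
open All using ([]; _∷_)
open import Data.List.Relation.Unary.AllPairs using ([]; _∷_)
open import Data.List.Relation.Unary.Unique.Propositional using (Unique)
import Data.List.Relation.Unary.Unique.Propositional.Properties as Unique
open import Data.Product using (∃-syntax; _×_; _,_; proj₂)
open import Data.Sum using (_⊎_; inj₁; inj₂)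
open import Data.Empty using (⊥-elim)
open import Function.Bundles using (mk⇔)
open import Function.Base using (it)
open import Induction.WellFounded using (Acc; acc)
open import Relation.Nullary using (¬_; yes; no)
open import Relation.Binary.Definitions using (tri<; tri≈; tri>)
open import Relation.Binary.PropositionalEquality
open import Data.Nat.Tactic.RingSolver using (solve-∀)

unique∧set⇒↭ : {xs ys : List ℕ} → Unique xs → Unique ys → xs ⊆ ys → ys ⊆ xs → xs ↭ ys
unique∧set⇒↭ !xs !ys xs⊆ys ys⊆xs = ∼bag⇒↭ (unique∧set⇒bag !xs !ys (mk⇔ xs⊆ys ys⊆xs))

sum-⊆ : {xs ys : List ℕ} → Unique xs → xs ⊆ ys → sum xs ≤ sum ys
sum-⊆ [] _ = z≤n
sum-⊆ {x ∷ xs} (x∉xs ∷ !xs) xs⊆ys with as , bs , refl ← ∈-∃++ (xs⊆ys (here refl)) = begin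
    x + sum xs          ≤⟨ +-monoʳ-≤ x (sum-⊆ !xs xs⊆as++bs) ⟩
    x + sum (as ++ bs)  ≡⟨ sum-↭ (shift x as bs) ⟨
    sum (as ++ x ∷ bs)  ∎
  where
  open ≤-Reasoning
  xs⊆as++bs : xs ⊆ as ++ bs
  xs⊆as++bs z∈xs with ∈-resp-↭ (shift x as bs) (xs⊆ys (there z∈xs))
  ... | here refl = ⊥-elim (All.lookup x∉xs z∈xs refl)
  ... | there z∈as++bs = z∈as++bs

sum-map-* : ∀ c xs → sum (map (c *_) xs) ≡ c * sum xs
sum-map-* c []       = sym (*-zeroʳ c)
sum-map-* c (x ∷ xs) = trans (cong (c * x +_) (sum-map-* c xs)) (sym (*-distribˡ-+ c x (sum xs)))

product-map-* : ∀ c xs → product (map (c *_) xs) ≡ c ^ length xs * product xs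
product-map-* c []       = refl
product-map-* c (x ∷ xs) =
  trans (cong (c * x *_) (product-map-* c xs)) (shuffle c x (c ^ length xs) (product xs))
  where
  shuffle : ∀ c x a b → c * x * (a * b) ≡ c * a * (x * b)
  shuffle = solve-∀

^-distribʳ-* : ∀ m n o → (m * n) ^ o ≡ m ^ o * n ^ o
^-distribʳ-* m n zero    = refl
^-distribʳ-* m n (suc o) = trans (cong (m * n *_) (^-distribʳ-* m n o)) (shuffle m n (m ^ o) (n ^ o))
  where
  shuffle : ∀ m n a b → m * n * (a * b) ≡ m * a * (n * b)
  shuffle = solve-∀

^-injectiveʳ : ∀ {m i j} → 1 < m → m ^ i ≡ m ^ j → i ≡ j
^-injectiveʳ {m} {i} {j} 1<m mⁱ≡mʲ with <-cmp i j
... | tri< i<j _ _ = ⊥-elim (<⇒≢ (^-monoʳ-< m 1<m i<j) mⁱ≡mʲ)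
... | tri≈ _ i≡j _ = i≡j
... | tri> _ _ j<i = ⊥-elim (<⇒≢ (^-monoʳ-< m 1<m j<i) (sym mⁱ≡mʲ))

∣⇒nonZero : ∀ {d n} → .{{NonZero n}} → d ∣ n → NonZero d
∣⇒nonZero {zero} {n} d∣n = ⊥-elim (≢-nonZero⁻¹ n (0∣⇒≡0 d∣n))
∣⇒nonZero {suc d} _ = _

divisors-unique : ∀ n → Unique (divisors n)
divisors-unique n = Unique.map⁺ suc-injective (Unique.filter⁺ _ (Unique.upTo⁺ n))

∈-divisors⁻ : ∀ {d n} → d ∈ divisors n → d ∣ n
∈-divisors⁻ {n = n} d∈ with _ , k∈ , refl ← ∈-map⁻ suc d∈ =
  proj₂ (∈-filter⁻ _ {xs = upTo n} k∈)

∈-divisors⁺ : ∀ {d n} → .{{NonZero n}} → d ∣ n → d ∈ divisors n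
∈-divisors⁺ {d} {n} d∣n with ∣⇒nonZero d∣n
∈-divisors⁺ {suc k} {n@(suc _)} d∣n | _ =
  ∈-map⁺ suc (∈-filter⁺ (λ k → suc k ∣? n) (∈-upTo⁺ (∣⇒≤ d∣n)) d∣n)

unitaryDivisors-unique : ∀ n → Unique (unitaryDivisors n)
unitaryDivisors-unique n = Unique.map⁺ suc-injective (Unique.filter⁺ _ (Unique.upTo⁺ n))

∈-unitaryDivisors⁻ : ∀ {d n} → d ∈ unitaryDivisors n → ∃[ e ] d * e ≡ n × Coprime d e
∈-unitaryDivisors⁻ {n = n} d∈ with k , k∈ , refl ← ∈-map⁻ suc d∈
  with d∣n , gcd≡1 ← proj₂ (∈-filter⁻ _ {xs = upTo n} k∈) =
  n / suc k , trans (*-comm (suc k) (n / suc k)) (m/n*n≡m d∣n) , gcd≡1⇒coprime gcd≡1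

∈-unitaryDivisors⁺ : ∀ {d e n} → .{{NonZero n}} → d * e ≡ n → Coprime d e → d ∈ unitaryDivisors n
∈-unitaryDivisors⁺ {d} {e} {n} de≡n d⊥e with ∣⇒nonZero (divides e (trans (sym de≡n) (*-comm d e)))
∈-unitaryDivisors⁺ {suc k} {e} refl d⊥e | _ =
  ∈-map⁺ suc (∈-filter⁺ _ (∈-upTo⁺ (∣⇒≤ d∣n)) (d∣n , gcd≡1))
  where
  d∣n : suc k ∣ suc k * e
  d∣n = m∣m*n e
  n/d≡e : suc k * e / suc k ≡ e
  n/d≡e = trans (cong (_/ suc k) (*-comm (suc k) e)) (m*n/n≡m e (suc k))
  gcd≡1 : gcd (suc k) (suc k * e / suc k) ≡ 1
  gcd≡1 = subst (λ m → gcd (suc k) m ≡ 1) (sym n/d≡e) (coprime⇒gcd≡1 d⊥e)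

Odd : ℕ → Set
Odd n = ¬ Even n

odd⇒nonZero : ∀ {n} → Odd n → NonZero n
odd⇒nonZero {zero}  odd = ⊥-elim (odd (2 ∣0))
odd⇒nonZero {suc n} _   = _

odd-∣ : ∀ {d n} → Odd n → d ∣ n → Odd d
odd-∣ odd d∣n 2∣d = odd (∣-trans 2∣d d∣n)

odd-* : ∀ {m n} → Odd m → Odd n → Odd (m * n)
odd-* {m} {n} odd-m odd-n 2∣mn with euclidsLemma m n prime[2] 2∣mn
... | inj₁ 2∣m = odd-m 2∣m
... | inj₂ 2∣n = odd-n 2∣n

odd∣2*n⇒∣n : ∀ {d n} → Odd d → d ∣ 2 * n → d ∣ n
odd∣2*n⇒∣n {d} odd = coprime-divisor d⊥2
  where
  d⊥2 : Coprime d 2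
  d⊥2 (e∣d , e∣2) with prime⇒irreducible prime[2] e∣2
  ... | inj₁ e≡1 = e≡1
  ... | inj₂ refl = ⊥-elim (odd e∣d)

odd∣2^k*n⇒∣n : ∀ k {d n} → Odd d → d ∣ 2 ^ k * n → d ∣ n
odd∣2^k*n⇒∣n zero    {d} {n} odd d∣n = subst (d ∣_) (*-identityˡ n) d∣n
odd∣2^k*n⇒∣n (suc k) {d} {n} odd d∣2ᵏ⁺¹n =
  odd∣2^k*n⇒∣n k odd (odd∣2*n⇒∣n odd (subst (d ∣_) (*-assoc 2 (2 ^ k) n) d∣2ᵏ⁺¹n))

even⊥⇒odd : ∀ {d e} → Coprime d e → Even d → Odd e
even⊥⇒odd d⊥e 2∣d 2∣e = 1+n≢0 (suc-injective (d⊥e (2∣d , 2∣e)))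

2^k⊥odd : ∀ k {n} → Odd n → Coprime (2 ^ k) n
2^k⊥odd k {n} odd {e} (e∣2ᵏ , e∣n) =
  ∣1⇒≡1 (odd∣2^k*n⇒∣n k (odd-∣ odd e∣n) (subst (e ∣_) (sym (*-identityʳ (2 ^ k))) e∣2ᵏ))

2∣2^k : ∀ {k} → .{{NonZero k}} → Even (2 ^ k)
2∣2^k {suc k} = m∣m*n (2 ^ k)

mersenne-odd : ∀ k → Odd (2 ^ suc k ∸ 1)
mersenne-odd k 2∣M = 1+n≢0 (suc-injective (∣1⇒≡1 (∣m+n∣m⇒∣n 2∣M+1 2∣M)))
  where
  2∣M+1 : 2 ∣ (2 ^ suc k ∸ 1) + 1
  2∣M+1 = subst (2 ∣_) (sym (m∸n+n≡m (m^n>0 2 (suc k)))) (2∣2^k {suc k})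

2^k*odd-factorisation : ∀ n → .{{NonZero n}} → ∃[ k ] ∃[ m ] Odd m × n ≡ 2 ^ k * m
2^k*odd-factorisation n = factorise n (<-wellFounded n)
  where
  factorise : ∀ n → Acc _<_ n → .{{NonZero n}} → ∃[ k ] ∃[ m ] Odd m × n ≡ 2 ^ k * m
  factorise n (acc smaller) with 2 ∣? n
  ... | no odd = 0 , n , odd , sym (*-identityˡ n)
  ... | yes (divides h refl) =
    let instance _ = m*n≢0⇒m≢0 h
        k , m , odd , h≡2ᵏm = factorise h (smaller (m<m*n h 2 (s≤s (s≤s z≤n))))
    in suc k , m , odd , (begin
      h * 2           ≡⟨ *-comm h 2 ⟩
      2 * h           ≡⟨ cong (2 *_) h≡2ᵏm ⟩
      2 * (2 ^ k * m) ≡⟨ *-assoc 2 (2 ^ k) m ⟨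
      2 ^ suc k * m   ∎)
    where open ≡-Reasoning

divisors₂ : ℕ → ℕ → List ℕ
divisors₂ zero    m = divisors m
divisors₂ (suc a) m = divisors m ++ map (2 *_) (divisors₂ a m)

divisors-2^[1+a]*odd : ∀ a {m} → Odd m →
  divisors (2 ^ suc a * m) ↭ divisors m ++ map (2 *_) (divisors (2 ^ a * m))
divisors-2^[1+a]*odd a {m} odd =
  unique∧set⇒↭ (divisors-unique (2 ^ suc a * m))
    (Unique.++⁺ (divisors-unique m) (Unique.map⁺ 2*-injective (divisors-unique n)) disjoint) into from
  where
  n = 2 ^ a * m
  instance
    m≢0 : NonZero m
    m≢0 = odd⇒nonZero odd
    n≢0 : NonZero n
    n≢0 = m*n≢0 (2 ^ a) m {{m^n≢0 2 a}}
    2n≢0 : NonZero (2 ^ suc a * m)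
    2n≢0 = m*n≢0 (2 ^ suc a) m {{m^n≢0 2 (suc a)}}
  2n≡2*n : 2 ^ suc a * m ≡ 2 * n
  2n≡2*n = *-assoc 2 (2 ^ a) m
  2*-injective : ∀ {x y} → 2 * x ≡ 2 * y → x ≡ y
  2*-injective {x} {y} = *-cancelˡ-≡ x y 2
  disjoint : ∀ {d} → ¬ (d ∈ divisors m × d ∈ map (2 *_) (divisors n))
  disjoint (d∈ , 2y∈) with y , _ , refl ← ∈-map⁻ (2 *_) 2y∈ = odd (∣-trans (m∣m*n y) (∈-divisors⁻ d∈))
  into : ∀ {d} → d ∈ divisors (2 ^ suc a * m) → d ∈ divisors m ++ map (2 *_) (divisors n)
  into {d} d∈ with 2 ∣? d
  ... | no odd-d = ∈-++⁺ˡ (∈-divisors⁺ (odd∣2^k*n⇒∣n (suc a) odd-d (∈-divisors⁻ d∈)))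
  ... | yes (divides h refl) = ∈-++⁺ʳ (divisors m) (subst (_∈ map (2 *_) (divisors n)) (*-comm 2 h) (∈-map⁺ (2 *_) h∈))
    where
    h∈ : h ∈ divisors n
    h∈ = ∈-divisors⁺ (*-cancelˡ-∣ {h} {n} 2 (subst₂ _∣_ (*-comm h 2) 2n≡2*n (∈-divisors⁻ d∈)))
  from : ∀ {d} → d ∈ divisors m ++ map (2 *_) (divisors n) → d ∈ divisors (2 ^ suc a * m)
  from d∈ with ∈-++⁻ (divisors m) d∈
  ... | inj₁ d∈m = ∈-divisors⁺ (∣-trans (∈-divisors⁻ d∈m) (n∣m*n (2 ^ suc a)))
  ... | inj₂ 2y∈ with y , y∈ , refl ← ∈-map⁻ (2 *_) 2y∈ =
    ∈-divisors⁺ (subst (2 * y ∣_) (sym 2n≡2*n) (*-monoʳ-∣ {y} {n} 2 (∈-divisors⁻ y∈)))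

divisors-2^a*odd : ∀ a {m} → Odd m → divisors (2 ^ a * m) ↭ divisors₂ a m
divisors-2^a*odd zero    {m} odd = subst (λ n → divisors n ↭ divisors m) (sym (*-identityˡ m)) ↭-refl
divisors-2^a*odd (suc a) {m} odd =
  ↭-trans (divisors-2^[1+a]*odd a odd) (++⁺ˡ (divisors m) (map⁺ (2 *_) (divisors-2^a*odd a odd)))

τ : ℕ → ℕ
τ n = length (divisors n)

triangle : ℕ → ℕ
triangle zero    = 0
triangle (suc n) = suc n + triangle n

triangle-2* : ∀ k → triangle (2 * k) ≡ k * suc (2 * k)
triangle-2* zero    = refl
triangle-2* (suc k) = begin
    triangle (2 * suc k)
      ≡⟨ cong triangle (*-suc 2 k) ⟩
    2 + 2 * k + (1 + 2 * k + triangle (2 * k))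
      ≡⟨ cong (λ t → 2 + 2 * k + (1 + 2 * k + t)) (triangle-2* k) ⟩
    2 + 2 * k + (1 + 2 * k + k * (1 + 2 * k))
      ≡⟨ expand k ⟩
    suc k * suc (2 * suc k)
      ∎
  where
  open ≡-Reasoning
  expand : ∀ k → 2 + 2 * k + (1 + 2 * k + k * (1 + 2 * k)) ≡ (1 + k) * (1 + 2 * (1 + k))
  expand = solve-∀

sum-divisors₂ : ∀ a m → sum (divisors₂ a m) + σ m ≡ 2 ^ suc a * σ m
sum-divisors₂ zero    m = cong (σ m +_) (sym (+-identityʳ (σ m)))
sum-divisors₂ (suc a) m = begin
    sum (divisors m ++ map (2 *_) (divisors₂ a m)) + σ m  ≡⟨ cong (_+ σ m) (sum-++ (divisors m) _) ⟩
    σ m + sum (map (2 *_) (divisors₂ a m)) + σ m          ≡⟨ cong (λ s → σ m + s + σ m) (sum-map-* 2 (divisors₂ a m)) ⟩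
    σ m + 2 * sum (divisors₂ a m) + σ m                   ≡⟨ regroup (σ m) (sum (divisors₂ a m)) ⟩
    2 * (sum (divisors₂ a m) + σ m)                       ≡⟨ cong (2 *_) (sum-divisors₂ a m) ⟩
    2 * (2 ^ suc a * σ m)                                 ≡⟨ *-assoc 2 (2 ^ suc a) (σ m) ⟨
    2 ^ suc (suc a) * σ m                                 ∎
  where
  open ≡-Reasoning
  regroup : ∀ s t → s + 2 * t + s ≡ 2 * (t + s)
  regroup = solve-∀

length-divisors₂ : ∀ a m → length (divisors₂ a m) ≡ suc a * τ m
length-divisors₂ zero    m = sym (+-identityʳ (τ m))
length-divisors₂ (suc a) m = trans (length-++ (divisors m))
  (cong (τ m +_) (trans (length-map (2 *_) (divisors₂ a m)) (length-divisors₂ a m)))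

product-divisors₂ : ∀ a m → product (divisors₂ a m) ≡ T m ^ suc a * 2 ^ (τ m * triangle a)
product-divisors₂ zero    m = begin
    T m                       ≡⟨ *-identityʳ (T m) ⟨
    T m ^ 1                   ≡⟨ *-identityʳ (T m ^ 1) ⟨
    T m ^ 1 * 2 ^ 0           ≡⟨ cong (λ e → T m ^ 1 * 2 ^ e) (*-zeroʳ (τ m)) ⟨
    T m ^ 1 * 2 ^ (τ m * 0)   ∎
  where open ≡-Reasoning
product-divisors₂ (suc a) m = begin
    product (divisors m ++ map (2 *_) (divisors₂ a m))
      ≡⟨ product-++ (divisors m) _ ⟩
    T m * product (map (2 *_) (divisors₂ a m))
      ≡⟨ cong (T m *_) (product-map-* 2 (divisors₂ a m)) ⟩
    T m * (2 ^ length (divisors₂ a m) * product (divisors₂ a m))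
      ≡⟨ cong₂ (λ l p → T m * (2 ^ l * p)) (length-divisors₂ a m) (product-divisors₂ a m) ⟩
    T m * (2 ^ (suc a * τ m) * (T m ^ suc a * 2 ^ (τ m * triangle a)))
      ≡⟨ regroup (T m) (T m ^ suc a) (2 ^ (suc a * τ m)) (2 ^ (τ m * triangle a)) ⟩
    T m * T m ^ suc a * (2 ^ (suc a * τ m) * 2 ^ (τ m * triangle a))
      ≡⟨ cong (T m ^ suc (suc a) *_) (^-distribˡ-+-* 2 (suc a * τ m) (τ m * triangle a)) ⟨
    T m ^ suc (suc a) * 2 ^ (suc a * τ m + τ m * triangle a)
      ≡⟨ cong (λ e → T m ^ suc (suc a) * 2 ^ e) (factor (suc a) (τ m) (triangle a)) ⟩
    T m ^ suc (suc a) * 2 ^ (τ m * triangle (suc a))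
      ∎
  where
  open ≡-Reasoning
  regroup : ∀ t u x y → t * (x * (u * y)) ≡ t * u * (x * y)
  regroup = solve-∀
  factor : ∀ s d t → s * d + d * t ≡ d * (s + t)
  factor = solve-∀

σ-2^a*odd : ∀ a {m} → Odd m → σ (2 ^ a * m) + σ m ≡ 2 ^ suc a * σ m
σ-2^a*odd a {m} odd = trans (cong (_+ σ m) (sum-↭ (divisors-2^a*odd a odd))) (sum-divisors₂ a m)

T-2^a*odd : ∀ a {m} → Odd m → T (2 ^ a * m) ≡ T m ^ suc a * 2 ^ (τ m * triangle a)
T-2^a*odd a {m} odd = trans (product-↭ (divisors-2^a*odd a odd)) (product-divisors₂ a m)

prime⇒1<p : ∀ {p} → Prime p → 1 < p
prime⇒1<p {p} (prime _) = nonTrivial⇒n>1 p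

divisors-prime : ∀ {p} → Prime p → divisors p ↭ 1 ∷ p ∷ []
divisors-prime {p} p-prime =
  unique∧set⇒↭ (divisors-unique p) ((<⇒≢ (prime⇒1<p p-prime) ∷ []) ∷ [] ∷ []) into from
  where
  instance _ = prime⇒nonZero p-prime
  into : ∀ {d} → d ∈ divisors p → d ∈ 1 ∷ p ∷ []
  into d∈ with prime⇒irreducible p-prime (∈-divisors⁻ d∈)
  ... | inj₁ refl = here refl
  ... | inj₂ refl = there (here refl)
  from : ∀ {d} → d ∈ 1 ∷ p ∷ [] → d ∈ divisors p
  from (here refl)         = ∈-divisors⁺ (1∣ p)
  from (there (here refl)) = ∈-divisors⁺ ∣-refl

∤prime⇒coprime : ∀ {p d} → Prime p → ¬ p ∣ d → Coprime d p
∤prime⇒coprime p-prime p∤d (e∣d , e∣p) with prime⇒irreducible p-prime e∣p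
... | inj₁ e≡1  = e≡1
... | inj₂ refl = ⊥-elim (p∤d e∣d)

divisors-prime² : ∀ {p} → Prime p → divisors (p * p) ↭ 1 ∷ p ∷ p * p ∷ []
divisors-prime² {p} p-prime = unique∧set⇒↭ (divisors-unique (p * p)) unique into from
  where
  instance
    _ = prime⇒nonZero p-prime
    _ = m*n≢0 p p
  1<p = prime⇒1<p p-prime
  p<p² : p < p * p
  p<p² = m<m*n p p 1<p
  unique : Unique (1 ∷ p ∷ p * p ∷ [])
  unique = (<⇒≢ 1<p ∷ <⇒≢ (<-trans 1<p p<p²) ∷ []) ∷ (<⇒≢ p<p² ∷ []) ∷ [] ∷ []
  into : ∀ {d} → d ∈ divisors (p * p) → d ∈ 1 ∷ p ∷ p * p ∷ []
  into {d} d∈ with p ∣? d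
  ... | yes (divides h refl) with prime⇒irreducible p-prime (*-cancelʳ-∣ {h} {p} p (∈-divisors⁻ d∈))
  ...   | inj₁ refl = there (here (*-identityˡ p))
  ...   | inj₂ refl = there (there (here refl))
  into {d} d∈ | no p∤d
    with prime⇒irreducible p-prime (coprime-divisor (∤prime⇒coprime p-prime p∤d) (∈-divisors⁻ d∈))
  ...   | inj₁ refl = here refl
  ...   | inj₂ refl = there (here refl)
  from : ∀ {d} → d ∈ 1 ∷ p ∷ p * p ∷ [] → d ∈ divisors (p * p)
  from (here refl)                 = ∈-divisors⁺ (1∣ (p * p))
  from (there (here refl))         = ∈-divisors⁺ (m∣m*n p)
  from (there (there (here refl))) = ∈-divisors⁺ ∣-refl

σ-prime : ∀ {p} → Prime p → σ p ≡ 1 + p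
σ-prime {p} p-prime = trans (sum-↭ (divisors-prime p-prime)) (cong suc (+-identityʳ p))

1+d+n≤σ[n] : ∀ {d n} → d ∣ n → d ≢ 1 → d < n → 1 + d + n ≤ σ n
1+d+n≤σ[n] {d} {n} d∣n d≢1 d<n = begin
    1 + d + n              ≡⟨ cong (λ m → 1 + (d + m)) (+-identityʳ n) ⟨
    sum (1 ∷ d ∷ n ∷ [])   ≤⟨ sum-⊆ unique ⊆divisors ⟩
    σ n                    ∎
  where
  open ≤-Reasoning
  instance _ = >-nonZero (≤-trans (s≤s z≤n) d<n)
  1<d : 1 < d
  1<d = ≤∧≢⇒< (>-nonZero⁻¹ d {{∣⇒nonZero d∣n}}) (≢-sym d≢1)
  unique : Unique (1 ∷ d ∷ n ∷ [])
  unique = (<⇒≢ 1<d ∷ <⇒≢ (<-trans 1<d d<n) ∷ []) ∷ (<⇒≢ d<n ∷ []) ∷ [] ∷ []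
  ⊆divisors : (1 ∷ d ∷ n ∷ []) ⊆ divisors n
  ⊆divisors (here refl)                 = ∈-divisors⁺ (1∣ n)
  ⊆divisors (there (here refl))         = ∈-divisors⁺ d∣n
  ⊆divisors (there (there (here refl))) = ∈-divisors⁺ ∣-refl

σ≡n+d⇒d≡1 : ∀ {d n} → d ∣ n → d < n → σ n ≡ n + d → d ≡ 1
σ≡n+d⇒d≡1 {d} {n} d∣n d<n σn≡n+d with d ≟ 1
... | yes d≡1 = d≡1
... | no  d≢1 = ⊥-elim (<⇒≱ (n<1+n (d + n)) (begin
    1 + d + n   ≤⟨ 1+d+n≤σ[n] d∣n d≢1 d<n ⟩
    σ n         ≡⟨ σn≡n+d ⟩
    n + d       ≡⟨ +-comm n d ⟩
    d + n       ∎))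
  where open ≤-Reasoning

σ≡1+n⇒prime : ∀ {n} → 1 < n → σ n ≡ 1 + n → Prime n
σ≡1+n⇒prime {n} 1<n σn≡1+n = irreducible⇒prime {{n>1⇒nonTrivial 1<n}} irreducible
  where
  instance _ = >-nonZero (<-trans (s≤s z≤n) 1<n)
  irreducible : ∀ {e} → e ∣ n → e ≡ 1 ⊎ e ≡ n
  irreducible {e} e∣n with e ≟ 1 | e ≟ n
  ... | yes e≡1 | _       = inj₁ e≡1
  ... | no  _   | yes e≡n = inj₂ e≡n
  ... | no  e≢1 | no  e≢n = ⊥-elim (<⇒≱ (+-monoʳ-< 1 (m<n+m n e>0)) (begin
      1 + e + n   ≤⟨ 1+d+n≤σ[n] e∣n e≢1 (≤∧≢⇒< (∣⇒≤ e∣n) e≢n) ⟩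
      σ n         ≡⟨ σn≡1+n ⟩
      1 + n       ∎))
    where
    open ≤-Reasoning
    e>0 = >-nonZero⁻¹ e {{∣⇒nonZero e∣n}}

1+mersenne≡2^ : ∀ k → 1 + (2 ^ suc k ∸ 1) ≡ 2 ^ suc k
1+mersenne≡2^ k = trans (+-comm 1 (2 ^ suc k ∸ 1)) (m∸n+n≡m (m^n>0 2 (suc k)))

1<mersenne : ∀ k → .{{NonZero k}} → 1 < 2 ^ suc k ∸ 1
1<mersenne (suc k) = ≤-trans (n≤1+n 2) (∸-monoˡ-≤ 1 (^-monoʳ-≤ 2 {2} {2 + k} (s≤s (s≤s z≤n))))

mersenne-prime⇒nonZero : ∀ {k} → Prime (2 ^ suc k ∸ 1) → NonZero k
mersenne-prime⇒nonZero {zero}  M-prime with s≤s () ← prime⇒1<p M-prime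
mersenne-prime⇒nonZero {suc k} _ = _

mersenne-perfect : ∀ k → Prime (2 ^ suc k ∸ 1) → Perfect (2 ^ k * (2 ^ suc k ∸ 1))
mersenne-perfect k M-prime = >-nonZero⁻¹ n , +-cancelʳ-≡ (1 + M) (σ n) (2 * n) (begin
    σ n + (1 + M)          ≡⟨ cong (σ n +_) (σ-prime M-prime) ⟨
    σ n + σ M              ≡⟨ σ-2^a*odd k (mersenne-odd k) ⟩
    P * σ M                ≡⟨ cong (P *_) (σ-prime M-prime) ⟩
    P * (1 + M)            ≡⟨ *-suc P M ⟩
    P + P * M              ≡⟨ cong₂ _+_ (1+mersenne≡2^ k) (sym (*-assoc 2 (2 ^ k) M)) ⟨
    (1 + M) + 2 * n        ≡⟨ +-comm (1 + M) (2 * n) ⟩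
    2 * n + (1 + M)        ∎)
  where
  open ≡-Reasoning
  P = 2 ^ suc k
  M = P ∸ 1
  n = 2 ^ k * M
  instance _ = m*n≢0 (2 ^ k) M {{m^n≢0 2 k}} {{odd⇒nonZero (mersenne-odd k)}}

perfect-2^k*odd⇒2^[1+k]*m≡mersenne*σm : ∀ k {m} → Odd m → σ (2 ^ k * m) ≡ 2 * (2 ^ k * m) →
  2 ^ suc k * m ≡ (2 ^ suc k ∸ 1) * σ m
perfect-2^k*odd⇒2^[1+k]*m≡mersenne*σm k {m} odd σn≡2n = +-cancelʳ-≡ (σ m) (P * m) (M * σ m) (begin
    P * m + σ m               ≡⟨ cong (_+ σ m) (trans (*-assoc 2 (2 ^ k) m) (sym σn≡2n)) ⟩
    σ (2 ^ k * m) + σ m       ≡⟨ σ-2^a*odd k odd ⟩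
    P * σ m                   ≡⟨ cong (_* σ m) (1+mersenne≡2^ k) ⟨
    (1 + M) * σ m             ≡⟨ +-comm (σ m) (M * σ m) ⟩
    M * σ m + σ m             ∎)
  where
  open ≡-Reasoning
  P = 2 ^ suc k
  M = P ∸ 1

perfect-2^k*odd⇒mersenne∣m : ∀ k {m} → Odd m → σ (2 ^ k * m) ≡ 2 * (2 ^ k * m) → (2 ^ suc k ∸ 1) ∣ m
perfect-2^k*odd⇒mersenne∣m k {m} odd σn≡2n = odd∣2^k*n⇒∣n (suc k) (mersenne-odd k)
  (subst ((2 ^ suc k ∸ 1) ∣_) (sym (perfect-2^k*odd⇒2^[1+k]*m≡mersenne*σm k odd σn≡2n)) (m∣m*n (σ m)))

perfect-2^k*odd⇒σ : ∀ k {m d} → Odd m → σ (2 ^ k * m) ≡ 2 * (2 ^ k * m) →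
  m ≡ d * (2 ^ suc k ∸ 1) → σ m ≡ m + d
perfect-2^k*odd⇒σ k {m} {d} odd σn≡2n m≡dM = *-cancelˡ-≡ (σ m) (m + d) M (begin
    M * σ m            ≡⟨ perfect-2^k*odd⇒2^[1+k]*m≡mersenne*σm k odd σn≡2n ⟨
    P * m              ≡⟨ cong (_* m) (1+mersenne≡2^ k) ⟨
    (1 + M) * m        ≡⟨ cong ((1 + M) *_) m≡dM ⟩
    (1 + M) * (d * M)  ≡⟨ expand M d ⟩
    M * (d * M + d)    ≡⟨ cong (λ x → M * (x + d)) m≡dM ⟨
    M * (m + d)        ∎)
  where
  open ≡-Reasoning
  P = 2 ^ suc k
  M = P ∸ 1
  instance _ = odd⇒nonZero (mersenne-odd k)
  expand : ∀ M d → (1 + M) * (d * M) ≡ M * (d * M + d)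
  expand = solve-∀

perfect-2^k*odd⇒mersenne : ∀ k {m} → .{{NonZero k}} → Odd m → σ (2 ^ k * m) ≡ 2 * (2 ^ k * m) →
  Prime (2 ^ suc k ∸ 1) × m ≡ 2 ^ suc k ∸ 1
perfect-2^k*odd⇒mersenne k {m} odd σn≡2n = M-prime , m≡M
  where
  M = 2 ^ suc k ∸ 1
  M∣m = perfect-2^k*odd⇒mersenne∣m k odd σn≡2n
  d = quotient M∣m
  m≡dM : m ≡ d * M
  m≡dM = _∣_.equality M∣m
  σm≡m+d = perfect-2^k*odd⇒σ k odd σn≡2n m≡dM
  instance
    _ = odd⇒nonZero odd
    _ = m*n≢0⇒m≢0 d {M} {{subst NonZero m≡dM it}}
  d≡1 : d ≡ 1
  d≡1 = σ≡n+d⇒d≡1 (quotient-∣ M∣m) (subst (d <_) (sym m≡dM) (m<m*n d M (1<mersenne k))) σm≡m+d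
  m≡M : m ≡ M
  m≡M = trans m≡dM (trans (cong (_* M) d≡1) (*-identityˡ M))
  M-prime : Prime M
  M-prime = σ≡1+n⇒prime (1<mersenne k) (begin
    σ M              ≡⟨ cong σ m≡M ⟨
    σ m              ≡⟨ σm≡m+d ⟩
    m + d            ≡⟨ cong₂ _+_ m≡M d≡1 ⟩
    M + 1            ≡⟨ +-comm M 1 ⟩
    1 + M            ∎)
    where open ≡-Reasoning

even-perfect⇒mersenne : ∀ {n} → Even n → Perfect n →
  ∃[ k ] Prime (2 ^ suc k ∸ 1) × n ≡ 2 ^ k * (2 ^ suc k ∸ 1)
even-perfect⇒mersenne {n} even (n>0 , σn≡2n) with 2^k*odd-factorisation n {{>-nonZero n>0}}
... | zero  , m , odd , refl = ⊥-elim (odd (subst Even (*-identityˡ m) even))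
... | suc k , m , odd , refl =
  let M-prime , m≡M = perfect-2^k*odd⇒mersenne (suc k) odd σn≡2n
  in suc k , M-prime , cong (2 ^ suc k *_) m≡M

-- A unitary divisor d = n / e of n = 2 ^ k * q has d or e odd, and an odd divisor of n divides q.
unitaryDivisors-2^k*prime : ∀ k {q} → .{{NonZero k}} → Prime q → Odd q →
  unitaryDivisors (2 ^ k * q) ↭ 1 ∷ 2 ^ k ∷ q ∷ 2 ^ k * q ∷ []
unitaryDivisors-2^k*prime k {q} q-prime odd-q = unique∧set⇒↭ (unitaryDivisors-unique n) unique into from
  where
  n = 2 ^ k * q
  instance
    _ = prime⇒nonZero q-prime
    _ = m^n≢0 2 k
    _ = m*n≢0 (2 ^ k) q
  1<q = prime⇒1<p q-prime
  1<2ᵏ : 1 < 2 ^ k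
  1<2ᵏ = ^-monoʳ-< 2 (s≤s (s≤s z≤n)) (>-nonZero⁻¹ k)
  q<n : q < n
  q<n = subst (q <_) (*-comm q (2 ^ k)) (m<m*n q (2 ^ k) 1<2ᵏ)
  unique : Unique (1 ∷ 2 ^ k ∷ q ∷ n ∷ [])
  unique = (<⇒≢ 1<2ᵏ ∷ <⇒≢ 1<q ∷ <⇒≢ (<-trans 1<q q<n) ∷ [])
         ∷ ((λ 2ᵏ≡q → odd-q (subst Even 2ᵏ≡q 2∣2^k)) ∷ <⇒≢ (m<m*n (2 ^ k) q 1<q) ∷ [])
         ∷ (<⇒≢ q<n ∷ [])
         ∷ [] ∷ []
  odd-divisor : ∀ {d} → Odd d → d ∣ n → d ≡ 1 ⊎ d ≡ q
  odd-divisor odd-d d∣n = prime⇒irreducible q-prime (odd∣2^k*n⇒∣n k odd-d d∣n)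
  classify : ∀ {d e} → d * e ≡ n → Coprime d e → d ∈ 1 ∷ 2 ^ k ∷ q ∷ n ∷ []
  classify {d} {e} de≡n d⊥e with 2 ∣? d
  ... | no odd-d with odd-divisor odd-d (divides e (trans (sym de≡n) (*-comm d e)))
  ...   | inj₁ refl = here refl
  ...   | inj₂ refl = there (there (here refl))
  classify {d} {e} de≡n d⊥e | yes 2∣d with odd-divisor (even⊥⇒odd d⊥e 2∣d) (divides d (sym de≡n))
  ...   | inj₁ refl = there (there (there (here (trans (sym (*-identityʳ d)) de≡n))))
  ...   | inj₂ refl = there (here (*-cancelʳ-≡ d (2 ^ k) q de≡n))
  into : ∀ {d} → d ∈ unitaryDivisors n → d ∈ 1 ∷ 2 ^ k ∷ q ∷ n ∷ []
  into d∈ = let _ , de≡n , d⊥e = ∈-unitaryDivisors⁻ d∈ in classify de≡n d⊥e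
  from : ∀ {d} → d ∈ 1 ∷ 2 ^ k ∷ q ∷ n ∷ [] → d ∈ unitaryDivisors n
  from (here refl)                         = ∈-unitaryDivisors⁺ (*-identityˡ n) (1-coprimeTo n)
  from (there (here refl))                 = ∈-unitaryDivisors⁺ refl (2^k⊥odd k odd-q)
  from (there (there (here refl)))         = ∈-unitaryDivisors⁺ (*-comm q (2 ^ k)) (Coprime.sym (2^k⊥odd k odd-q))
  from (there (there (there (here refl)))) = ∈-unitaryDivisors⁺ (*-identityʳ n) (Coprime.sym (1-coprimeTo n))

T*-2^k*prime : ∀ k {q} → .{{NonZero k}} → Prime q → Odd q → T* (2 ^ k * q) ≡ (2 ^ k * q) * (2 ^ k * q)
T*-2^k*prime k {q} q-prime odd-q =
  trans (product-↭ (unitaryDivisors-2^k*prime k q-prime odd-q)) (multiply (2 ^ k) q)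
  where
  multiply : ∀ a q → 1 * (a * (q * (a * q * 1))) ≡ a * q * (a * q)
  multiply = solve-∀

T-prime² : ∀ {p} → Prime p → T (p * p) ≡ p ^ 3
T-prime² {p} p-prime = trans (product-↭ (divisors-prime² p-prime)) (multiply p)
  where
  multiply : ∀ p → 1 * (p * (p * p * 1)) ≡ p * (p * (p * 1))
  multiply = solve-∀

T-[2^k*odd-prime]² : ∀ k {q} → Prime q → Odd q →
  T ((2 ^ k * q) * (2 ^ k * q)) ≡ (2 ^ k * q) ^ (3 * suc (2 * k))
T-[2^k*odd-prime]² k {q} q-prime odd-q = begin
    T ((2 ^ k * q) * (2 ^ k * q))
      ≡⟨ cong T square ⟩
    T (2 ^ (2 * k) * (q * q))
      ≡⟨ T-2^a*odd (2 * k) (odd-* odd-q odd-q) ⟩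
    T (q * q) ^ E * 2 ^ (τ (q * q) * triangle (2 * k))
      ≡⟨ cong₂ (λ t d → t ^ E * 2 ^ (d * triangle (2 * k))) (T-prime² q-prime) (↭-length (divisors-prime² q-prime)) ⟩
    (q ^ 3) ^ E * 2 ^ (3 * triangle (2 * k))
      ≡⟨ cong (λ t → (q ^ 3) ^ E * 2 ^ (3 * t)) (triangle-2* k) ⟩
    (q ^ 3) ^ E * 2 ^ (3 * (k * E))
      ≡⟨ cong₂ _*_ (^-*-assoc q 3 E) (cong (2 ^_) (reassociate k E)) ⟩
    q ^ (3 * E) * 2 ^ (k * (3 * E))
      ≡⟨ *-comm (q ^ (3 * E)) _ ⟩
    2 ^ (k * (3 * E)) * q ^ (3 * E)
      ≡⟨ cong (_* q ^ (3 * E)) (^-*-assoc 2 k (3 * E)) ⟨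
    (2 ^ k) ^ (3 * E) * q ^ (3 * E)
      ≡⟨ ^-distribʳ-* (2 ^ k) q (3 * E) ⟨
    (2 ^ k * q) ^ (3 * E)
      ∎
  where
  open ≡-Reasoning
  E = suc (2 * k)
  square : (2 ^ k * q) * (2 ^ k * q) ≡ 2 ^ (2 * k) * (q * q)
  square = begin
    (2 ^ k * q) * (2 ^ k * q)  ≡⟨ regroup (2 ^ k) q ⟩
    (2 ^ k * 2 ^ k) * (q * q)  ≡⟨ cong (_* (q * q)) (^-distribˡ-+-* 2 k k) ⟨
    2 ^ (k + k) * (q * q)      ≡⟨ cong (λ e → 2 ^ (k + e) * (q * q)) (+-identityʳ k) ⟨
    2 ^ (2 * k) * (q * q)      ∎
    where
    regroup : ∀ a q → a * q * (a * q) ≡ a * a * (q * q)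
    regroup = solve-∀
  reassociate : ∀ k E → 3 * (k * E) ≡ k * (3 * E)
  reassociate = solve-∀

T∘T*-2^k*prime : ∀ k {q} → .{{NonZero k}} → Prime q → Odd q →
  T (T* (2 ^ k * q)) ≡ (2 ^ k * q) ^ (3 * suc (2 * k))
T∘T*-2^k*prime k q-prime odd-q =
  trans (cong T (T*-2^k*prime k q-prime odd-q)) (T-[2^k*odd-prime]² k q-prime odd-q)

mersenne-KT0TStarPerfect : ∀ k → Prime (2 ^ suc k ∸ 1) →
  KT0TStarPerfect (3 * suc (2 * k)) (2 ^ k * (2 ^ suc k ∸ 1))
mersenne-KT0TStarPerfect k M-prime = ≤-trans (n≤1+n 2) (m≤m*n 3 (suc (2 * k))) , 1<N ,
  T∘T*-2^k*prime k M-prime (mersenne-odd k)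
  where
  instance _ = mersenne-prime⇒nonZero M-prime
  M = 2 ^ suc k ∸ 1
  1<N : 1 < 2 ^ k * M
  1<N = <-≤-trans (1<mersenne k) (m≤n*m M (2 ^ k) {{m^n≢0 2 k}})

even-perfect-KT0TStarPerfect⇒≡ : ∀ k {n} → Even n → Perfect n → KT0TStarPerfect (3 * suc (2 * k)) n →
  n ≡ 2 ^ k * (2 ^ suc k ∸ 1)
even-perfect-KT0TStarPerfect⇒≡ k even perfect (_ , 1<n , T∘T*n≡nᴷ)
  with j , Mⱼ-prime , refl ← even-perfect⇒mersenne even perfect =
  cong (λ i → 2 ^ i * (2 ^ suc i ∸ 1)) j≡k
  where
  instance _ = mersenne-prime⇒nonZero Mⱼ-prime
  3[1+2j]≡3[1+2k] : 3 * suc (2 * j) ≡ 3 * suc (2 * k)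
  3[1+2j]≡3[1+2k] = ^-injectiveʳ 1<n (trans (sym (T∘T*-2^k*prime j Mⱼ-prime (mersenne-odd j))) T∘T*n≡nᴷ)
  j≡k : j ≡ k
  j≡k = *-cancelˡ-≡ j k 2 (suc-injective (*-cancelˡ-≡ _ _ 3 3[1+2j]≡3[1+2k]))

2*[1+k]∸1≡1+2*k : ∀ k → 2 * suc k ∸ 1 ≡ suc (2 * k)
2*[1+k]∸1≡1+2*k k = cong (_∸ 1) (*-suc 2 k)

theorem3p12 : (p : ℕ) → Prime p → Prime (2 ^ p ∸ 1) →
    (Even (2 ^ (p ∸ 1) * (2 ^ p ∸ 1)) × Perfect (2 ^ (p ∸ 1) * (2 ^ p ∸ 1))
      × KT0TStarPerfect (3 * (2 * p ∸ 1)) (2 ^ (p ∸ 1) * (2 ^ p ∸ 1)))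
    × ((n : ℕ) → Even n → Perfect n → KT0TStarPerfect (3 * (2 * p ∸ 1)) n →
         n ≡ 2 ^ (p ∸ 1) * (2 ^ p ∸ 1))
theorem3p12 zero    _ M-prime with () ← prime⇒1<p M-prime
theorem3p12 (suc k) _ M-prime rewrite 2*[1+k]∸1≡1+2*k k =
  (even , mersenne-perfect k M-prime , mersenne-KT0TStarPerfect k M-prime) ,
  λ _ → even-perfect-KT0TStarPerfect⇒≡ k
  where
  instance _ = mersenne-prime⇒nonZero M-prime
  even : Even (2 ^ k * (2 ^ suc k ∸ 1))
  even = ∣m⇒∣m*n (2 ^ suc k ∸ 1) (2∣2^k {k})
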